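{- Let $n\ge 0$ be an integer. Let $c>0$ be such that $1/c$ is an integer, let $\varepsilon>0$ with $\varepsilon\le 2^{ -n-2}$, and let $G$ be an $\varepsilon$-sparse $(\varepsilon|G|^{1-c},\varepsilon|G|)$-coherent graph with $|G|>1$. Then there is a covering sequence $(\mathcal{L}_1,\ldots,\mathcal{L}_n)$ in $G$, where $\mathcal{L}_i=(a_i,H_i,B_i)$ for $1\le i\le n$, such that: for $1\le i<j\le n$, $H_i$ is anticomplete to $B_j$; for $1\le i\le n$, $\mathcal{L}_i$ has height at most $1/c$; and for $1\le i\le n$, $|B_i|\ge 2^{ -i-1}|G|$.
   Context: Graphs are finite, without loops or parallel edges; $|G|$ is the number of vertices. $G$ is $\varepsilon$-sparse if every vertex has degree less than $\varepsilon|G|$. For reals $\alpha,\beta$, $G$ is $(\alpha,\beta)$-coherent if there do not exist disjoint subsets $A,B$ of $V(G)$, anticomplete to each other (no edge between them), with $|A|\ge\alpha$ and $|B|\ge\beta$. For disjoint $A,B$, $A$ covers $B$ if every vertex of $B$ has a neighbour in $A$. A covering in $G$ is a triple $(a,H,B)$ where $H,B$ are disjoint subsets of $V(G)$, $a\in H$, $H$ covers $B$, and $G[H]$ is connected; $a$ is its apex, $H$ its heart, $B$ its base. It has height at most $r$ if for every $v\in H$ there is a path of $G[H]$ between $a$ and $v$ of length at most $r-1$. A covering sequence is a sequence of coverings whose hearts are pairwise disjoint and pairwise anticomplete.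
   Formalization: The parameter ε is taken to be a positive rational. -}

module Defs where

open import Data.Nat using (ℕ; zero; suc; _+_; _*_; _∸_; _^_; _≤_; _<_)
open import Data.Fin using (Fin; toℕ)
open import Data.Fin.Subset using (Subset; _∈_; ∣_∣)
open import Data.Bool using (Bool; true; false)
open import Data.Vec using (tabulate)
open import Data.List using (List; []; _∷_)
open import Data.List.Relation.Unary.Unique.Propositional using (Unique)
open import Data.Product using (Σ; ∃; ∃-syntax; _×_; _,_)
open import Data.Empty using (⊥)
open import Relation.Nullary using (¬_)
open import Relation.Binary.PropositionalEquality using (_≡_; _≢_)

record Graph (N : ℕ) : Set where
  field
    E     : Fin N → Fin N → Bool
    sym   : ∀ u v → E u v ≡ E v u
    irref : ∀ v → E v v ≡ false
open Graph public

module _ {N : ℕ} (G : Graph N) where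

  Adj : Fin N → Fin N → Set
  Adj u v = E G u v ≡ true

  nbhd : Fin N → Subset N
  nbhd v = tabulate (λ u → E G v u)

  degree : Fin N → ℕ
  degree v = ∣ nbhd v ∣

  data WalkIn (H : Subset N) : Fin N → Fin N → ℕ → Set where
    here : ∀ {v} → v ∈ H → WalkIn H v v 0
    step : ∀ {u w v ℓ} → u ∈ H → Adj u w → WalkIn H w v ℓ → WalkIn H u v (suc ℓ)

  verts : ∀ {H u v ℓ} → WalkIn H u v ℓ → List (Fin N)
  verts (here {v} _) = v ∷ []
  verts (step {u} _ _ w) = u ∷ verts w

  PathIn : Subset N → Fin N → Fin N → ℕ → Set
  PathIn H u v ℓ = Σ (WalkIn H u v ℓ) (λ w → Unique (verts w))

  ConnectedIn : Subset N → Set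
  ConnectedIn H = ∀ u v → u ∈ H → v ∈ H → ∃[ ℓ ] PathIn H u v ℓ

  Disjoint : Subset N → Subset N → Set
  Disjoint A B = ∀ v → v ∈ A → v ∈ B → ⊥

  Anticomplete : Subset N → Subset N → Set
  Anticomplete A B = ∀ u v → u ∈ A → v ∈ B → ¬ Adj u v

  Covers : Subset N → Subset N → Set
  Covers A B = ∀ v → v ∈ B → ∃[ u ] (u ∈ A × Adj u v)

  record Covering : Set where
    field
      apex      : Fin N
      heart     : Subset N
      base      : Subset N
      disjHB    : Disjoint heart base
      apex∈     : apex ∈ heart
      covers    : Covers heart base
      connected : ConnectedIn heart

  open Covering public

  HeightAtMost : ℕ → Covering → Set
  HeightAtMost r L = ∀ v → v ∈ heart L →
    ∃[ ℓ ] (suc ℓ ≤ r × PathIn (heart L) (apex L) v ℓ)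

  IsCoveringSequence : {n : ℕ} → (Fin n → Covering) → Set
  IsCoveringSequence {n} L = ∀ (i j : Fin n) → i ≢ j →
    Disjoint (heart (L i)) (heart (L j)) × Anticomplete (heart (L i)) (heart (L j))

  -- ε = p / q with q > 0.  ε-sparse: every vertex has degree < ε N.
  Sparse : ℕ → ℕ → Set
  Sparse p q = ∀ v → degree v * q < p * N

  -- (ε N^{1-c}, ε N)-coherent with ε = p/q and c = 1/k (k ≥ 1):
  -- |A| ≥ (p/q) N^{1-1/k}  ⇔  |A|^k q^k ≥ p^k N^{k-1}, and |B| ≥ (p/q) N ⇔ |B| q ≥ p N.
  Coherent : ℕ → ℕ → ℕ → Set
  Coherent k p q = ∀ (A B : Subset N) → Disjoint A B → Anticomplete A B →
    (p ^ k) * (N ^ (k ∸ 1)) ≤ (∣ A ∣ ^ k) * (q ^ k) →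
    p * N ≤ ∣ B ∣ * q → ⊥

module Submission where

-- Write ε = p/q, c = 1/k and ρ = ⌊N^c⌋. The coverings are found greedily inside a shrinking
-- set W ⊆ V(G); the i-th one (counting from 0) gets a base of at least N/K vertices, K = 2^(i+2).
--
-- Ball lemma: if |W| ≥ 3εN then some a ∈ W has at least εN^(1-c) vertices at distance < k
-- from it in G[W]. Otherwise, by induction on m, the (k-1-m)-th closed neighbourhood in G[W]
-- of any set of at most (2ρ)^m vertices has fewer than εN/ρ vertices: splitting the set into
-- 2ρ parts, the next neighbourhood has fewer than 2εN vertices, so at least εN vertices of W
-- are remote from it (outside its closed neighbourhood), and coherence bounds it. For
-- m = k-1 this contradicts |W| ≥ 3εN.
--
-- By coherence the big ball leaves fewer than εN vertices of W remote. Growing it layer by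
-- layer, one vertex at a time, we stop at the first heart H whose closed neighbourhood N[H] in
-- G[W] has at least N/K + 2εN vertices. Before the last vertex was added at least εN vertices
-- were remote, so |H| ≤ εN + 1 by coherence; hence the base N[H] ∖ H has at least N/K vertices,
-- and by sparseness |N[H]| < N/K + 4εN. The later coverings live in W ∖ N[H], with K doubled;
-- ε ≤ 2^(-n-2) leaves W large enough for all n stages.

open import Defs hiding (sym)
open import Data.Nat using (ℕ; zero; suc; _+_; _*_; _^_; _∸_; _≤_; _<_; z≤n; s≤s; z<s; s≤s⁻¹; _<ᵇ_; >-nonZero)
open import Data.Nat.Properties
open import Data.Nat.Tactic.RingSolver using (solve-∀)
open import Data.Bool using (Bool; true)
open import Data.Bool.Properties using (T-≡)
import Data.Bool.Properties as Boolₚ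
open import Data.Fin using (Fin; zero; suc; toℕ; fromℕ<)
import Data.Fin as Fin
open import Data.Fin.Properties using (any?; toℕ<n; toℕ-fromℕ<; toℕ-injective)
import Data.Fin.Properties as Finₚ
open import Data.Fin.Subset
open import Data.Fin.Subset.Properties
open import Data.Vec using ([]; _∷_; tabulate; here; there)
open import Data.Vec.Properties using (lookup∘tabulate; []=⇒lookup; lookup⇒[]=)
open import Data.List.Relation.Unary.All using (All; []; _∷_)
open import Data.List.Relation.Unary.AllPairs using ([]; _∷_)
open import Data.List.Relation.Unary.Unique.Propositional using (Unique)
open import Data.Product using (Σ; ∃-syntax; _×_; _,_; proj₁; proj₂)
open import Data.Sum using (_⊎_; inj₁; inj₂; [_,_])
open import Data.Empty using (⊥-elim)
import Data.Empty as Empty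
open import Function using (_∘_; Equivalence)
open import Relation.Nullary using (¬_; Dec; yes; no; contradiction)
open import Relation.Nullary.Decidable using (⌊_⌋; _×-dec_; toWitness; fromWitness)
open import Relation.Unary using (Decidable)
open import Relation.Binary.PropositionalEquality using (_≡_; _≢_; refl; sym; trans; cong; subst; subst₂)

-- Arithmetic

crossing : ∀ {Q : ℕ → Set} → Decidable Q → ¬ Q 0 → ∀ {m} → Q m →
  ∃[ j ] (j < m × ¬ Q j × Q (suc j))
crossing Q? ¬Q0 {zero} Q0 = contradiction Q0 ¬Q0
crossing Q? ¬Q0 {suc m} Q1+m with Q? m
... | no ¬Qm = m , ≤-refl , ¬Qm , Q1+m
... | yes Qm with crossing Q? ¬Q0 Qm
...   | j , j<m , crossed = j , m<n⇒m<1+n j<m , crossed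

∃-root : ∀ k' {N} → 0 < N → ∃[ ρ ] (1 ≤ ρ × ρ ^ suc k' ≤ N × N < suc ρ ^ suc k')
∃-root k' {N} 0<N with crossing (λ j → N <? suc j ^ suc k') N≮1 N<[1+N]^k
  where
  N≮1 : ¬ N < 1 ^ suc k'
  N≮1 N<1 rewrite ^-zeroˡ (suc k') = <⇒≱ N<1 0<N
  N<[1+N]^k : N < suc N ^ suc k'
  N<[1+N]^k = m≤m*n (suc N) (suc N ^ k') {{m^n≢0 (suc N) k'}}
... | j , _ , ¬below , below = suc j , s≤s z≤n , ≮⇒≥ ¬below , below

^-distribʳ-* : ∀ m n o → (m * n) ^ o ≡ m ^ o * n ^ o
^-distribʳ-* m n zero = refl
^-distribʳ-* m n (suc o) = trans (cong (m * n *_) (^-distribʳ-* m n o)) (interchange m n (m ^ o) (n ^ o))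
  where
  interchange : ∀ a b c d → a * b * (c * d) ≡ a * c * (b * d)
  interchange = solve-∀

n<2^n : ∀ n → n < 2 ^ n
n<2^n zero = s≤s z≤n
n<2^n (suc n) = +-mono-≤ (m^n>0 2 n) (≤-trans (n<2^n n) (m≤m+n (2 ^ n) 0))

8*n≤2^[n+2] : ∀ n → 8 * n ≤ 2 ^ (n + 2)
8*n≤2^[n+2] n = begin
  8 * n           ≡⟨ *-assoc 4 2 n ⟩
  4 * (2 * n)     ≤⟨ *-monoʳ-≤ 4 (2*n≤2^n n) ⟩
  4 * 2 ^ n       ≡⟨ *-comm 4 (2 ^ n) ⟩
  2 ^ n * 2 ^ 2   ≡⟨ ^-distribˡ-+-* 2 n 2 ⟨
  2 ^ (n + 2)     ∎
  where
  open ≤-Reasoning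
  2*n≤2^n : ∀ n → 2 * n ≤ 2 ^ n
  2*n≤2^n zero = z≤n
  2*n≤2^n (suc n) = *-monoʳ-≤ 2 (n<2^n n)

m+m≡2*m : ∀ m → m + m ≡ 2 * m
m+m≡2*m m = cong (m +_) (sym (+-identityʳ m))

-- In these names ε = p/q and c = 1/(k'+1); εN¹⁻ᶜ≤ x is the integer form of x ≥ εN^(1-c)
-- used by Coherent.
εN/ρ≤⇒εN¹⁻ᶜ≤ : ∀ k' {p q} x {ρ N} → 0 < N → ρ ^ suc k' ≤ N → p * N ≤ x * (q * ρ) →
  p ^ suc k' * N ^ k' ≤ x ^ suc k' * q ^ suc k'
εN/ρ≤⇒εN¹⁻ᶜ≤ k' {p} {q} x {ρ} {N} 0<N ρ^k≤N pN≤xqρ = *-cancelʳ-≤ _ _ N {{>-nonZero 0<N}} (begin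
  p ^ k * N ^ k' * N           ≡⟨ shift (p ^ k) (N ^ k') N ⟩
  p ^ k * N ^ k                ≡⟨ ^-distribʳ-* p N k ⟨
  (p * N) ^ k                  ≤⟨ ^-monoˡ-≤ k pN≤xqρ ⟩
  (x * (q * ρ)) ^ k            ≡⟨ ^-distribʳ-* x (q * ρ) k ⟩
  x ^ k * (q * ρ) ^ k          ≡⟨ cong (x ^ k *_) (^-distribʳ-* q ρ k) ⟩
  x ^ k * (q ^ k * ρ ^ k)      ≤⟨ *-monoʳ-≤ (x ^ k) (*-monoʳ-≤ (q ^ k) ρ^k≤N) ⟩
  x ^ k * (q ^ k * N)          ≡⟨ *-assoc (x ^ k) (q ^ k) N ⟨
  x ^ k * q ^ k * N            ∎)
  where
  open ≤-Reasoning
  k = suc k'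
  shift : ∀ a b c → a * b * c ≡ a * (c * b)
  shift = solve-∀

εN≤⇒εN¹⁻ᶜ≤ : ∀ k' {p q} x {N} → 0 < N → p * N ≤ x * q →
  p ^ suc k' * N ^ k' ≤ x ^ suc k' * q ^ suc k'
εN≤⇒εN¹⁻ᶜ≤ k' {p} {q} x {N} 0<N pN≤xq = εN/ρ≤⇒εN¹⁻ᶜ≤ k' {p} {q} x {1} 0<N 1^k≤N
  (≤-trans pN≤xq (≤-reflexive (cong (x *_) (sym (*-identityʳ q)))))
  where
  1^k≤N : 1 ^ suc k' ≤ N
  1^k≤N = ≤-trans (≤-reflexive (^-zeroˡ (suc k'))) 0<N

p*N≤[2ρ]^k'*[q*ρ] : ∀ k' {p q ρ N} → 1 ≤ ρ → N < suc ρ ^ suc k' → 2 * p ≤ q →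
  p * N ≤ (2 * ρ) ^ k' * (q * ρ)
p*N≤[2ρ]^k'*[q*ρ] k' {p} {q} {ρ} {N} 1≤ρ N<[1+ρ]^k 2p≤q = begin
  p * N                       ≤⟨ *-monoʳ-≤ p (<⇒≤ N<[1+ρ]^k) ⟩
  p * suc ρ ^ suc k'          ≤⟨ *-monoʳ-≤ p (^-monoˡ-≤ (suc k') 1+ρ≤2ρ) ⟩
  p * (2 * ρ) ^ suc k'        ≡⟨ regroup p ρ ((2 * ρ) ^ k') ⟩
  (2 * ρ) ^ k' * (2 * p * ρ)  ≤⟨ *-monoʳ-≤ ((2 * ρ) ^ k') (*-monoˡ-≤ ρ 2p≤q) ⟩
  (2 * ρ) ^ k' * (q * ρ)      ∎
  where
  open ≤-Reasoning
  1+ρ≤2ρ : suc ρ ≤ 2 * ρ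
  1+ρ≤2ρ = ≤-trans (+-monoˡ-≤ ρ 1≤ρ) (≤-reflexive (cong (ρ +_) (sym (+-identityʳ ρ))))
  regroup : ∀ p ρ X → p * (2 * ρ * X) ≡ X * (2 * p * ρ)
  regroup = solve-∀

large-remainder : ∀ A {P w y o z} → A + 3 * P ≤ w * z → w ≤ y + o → y * z < A + 2 * P → P ≤ o * z
large-remainder A {P} {w} {y} {o} {z} budget w≤y+o yz< = +-cancelˡ-≤ (A + 2 * P) _ _ (<⇒≤ (begin-strict
  A + 2 * P + P      ≡⟨ regroup A P ⟩
  A + 3 * P          ≤⟨ budget ⟩
  w * z              ≤⟨ *-monoˡ-≤ z w≤y+o ⟩
  (y + o) * z        ≡⟨ *-distribʳ-+ z y o ⟩
  y * z + o * z      <⟨ +-monoˡ-< (o * z) yz< ⟩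
  A + 2 * P + o * z  ∎))
  where
  open ≤-Reasoning
  regroup : ∀ A P → A + 2 * P + P ≡ A + 3 * P
  regroup = solve-∀

large-part : ∀ A {P w y o z} → A + 3 * P ≤ w * z → w ≤ y + o → o * z < P → A + 2 * P ≤ y * z
large-part A {P} {w} {y} {o} {z} budget w≤y+o oz<P = +-cancelʳ-≤ P _ _ (<⇒≤ (begin-strict
  A + 2 * P + P      ≡⟨ regroup A P ⟩
  A + 3 * P          ≤⟨ budget ⟩
  w * z              ≤⟨ *-monoˡ-≤ z w≤y+o ⟩
  (y + o) * z        ≡⟨ *-distribʳ-+ z y o ⟩
  y * z + o * z      <⟨ +-monoʳ-< (y * z) oz<P ⟩
  y * z + P          ∎))
  where
  open ≤-Reasoning
  regroup : ∀ A P → A + 2 * P + P ≡ A + 3 * P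
  regroup = solve-∀

large-difference : ∀ A {P y h b z} → A + 2 * P ≤ y * z → y ≤ h + b → h * z < 2 * P → A < b * z
large-difference A {P} {y} {h} {b} {z} A+2P≤yz y≤h+b hz<2P = +-cancelʳ-< (2 * P) _ _ (begin-strict
  A + 2 * P          ≤⟨ A+2P≤yz ⟩
  y * z              ≤⟨ *-monoˡ-≤ z y≤h+b ⟩
  (h + b) * z        ≡⟨ *-distribʳ-+ z h b ⟩
  h * z + b * z      <⟨ +-monoˡ-< (b * z) hz<2P ⟩
  2 * P + b * z      ≡⟨ +-comm (2 * P) (b * z) ⟩
  b * z + 2 * P      ∎)
  where open ≤-Reasoning

budget⇒stage-budget : ∀ d {A P w q K} → A + 4 * suc d * (P * K) ≤ (w * q + P) * K →
  A + 3 * (P * (2 * K)) ≤ w * (q * (2 * K))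
budget⇒stage-budget d {A} {P} {w} {q} {K} budget = +-cancelʳ-≤ (A + 8 * d * (P * K) + 2 * (P * K)) _ _ (begin
  A + 3 * (P * (2 * K)) + (A + 8 * d * (P * K) + 2 * (P * K))  ≡⟨ lhs A P K d ⟩
  2 * (A + 4 * suc d * (P * K))                                  ≤⟨ *-monoʳ-≤ 2 budget ⟩
  2 * ((w * q + P) * K)                                          ≡⟨ rhs w q P K ⟩
  w * (q * (2 * K)) + 2 * (P * K)                                ≤⟨ +-monoʳ-≤ (w * (q * (2 * K))) (m≤n+m (2 * (P * K)) (A + 8 * d * (P * K))) ⟩
  w * (q * (2 * K)) + (A + 8 * d * (P * K) + 2 * (P * K))       ∎)
  where
  open ≤-Reasoning
  lhs : ∀ A P K d → A + 3 * (P * (2 * K)) + (A + 8 * d * (P * K) + 2 * (P * K)) ≡ 2 * (A + 4 * suc d * (P * K))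
  lhs = solve-∀
  rhs : ∀ w q P K → 2 * ((w * q + P) * K) ≡ w * (q * (2 * K)) + 2 * (P * K)
  rhs = solve-∀

stage-budget⇒3εN : ∀ {A P w q K} → 0 < K → A + 3 * (P * K) ≤ w * (q * K) → 3 * P ≤ w * q
stage-budget⇒3εN {A} {P} {w} {q} {K} 0<K stage-budget = *-cancelʳ-≤ _ _ K {{>-nonZero 0<K}} (begin
  3 * P * K       ≡⟨ *-assoc 3 P K ⟩
  3 * (P * K)     ≤⟨ m≤n+m _ A ⟩
  A + 3 * (P * K) ≤⟨ stage-budget ⟩
  w * (q * K)     ≡⟨ *-assoc w q K ⟨
  w * q * K       ∎)
  where open ≤-Reasoning

budget-step : ∀ d {A P w w' q K} → A + 4 * suc d * (P * K) ≤ (w * q + P) * K →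
  w * (q * (2 * K)) < A + 4 * (P * (2 * K)) + w' * (q * (2 * K)) →
  A + 4 * d * (P * (2 * K)) ≤ (w' * q + P) * (2 * K)
budget-step d {A} {P} {w} {w'} {q} {K} budget remote-large = <⇒≤ (+-cancelʳ-< (A + 8 * (P * K)) _ _ (begin-strict
  A + 4 * d * (P * (2 * K)) + (A + 8 * (P * K))                   ≡⟨ lhs A P K d ⟩
  2 * (A + 4 * suc d * (P * K))                                    ≤⟨ *-monoʳ-≤ 2 budget ⟩
  2 * ((w * q + P) * K)                                            ≡⟨ mid w q P K ⟩
  w * (q * (2 * K)) + 2 * (P * K)                                  <⟨ +-monoˡ-< (2 * (P * K)) remote-large ⟩
  A + 4 * (P * (2 * K)) + w' * (q * (2 * K)) + 2 * (P * K)        ≡⟨ rhs A P K w' q ⟩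
  (w' * q + P) * (2 * K) + (A + 8 * (P * K))                      ∎))
  where
  open ≤-Reasoning
  lhs : ∀ A P K d → A + 4 * d * (P * (2 * K)) + (A + 8 * (P * K)) ≡ 2 * (A + 4 * suc d * (P * K))
  lhs = solve-∀
  mid : ∀ w q P K → 2 * ((w * q + P) * K) ≡ w * (q * (2 * K)) + 2 * (P * K)
  mid = solve-∀
  rhs : ∀ A P K w' q → A + 4 * (P * (2 * K)) + w' * (q * (2 * K)) + 2 * (P * K) ≡ (w' * q + P) * (2 * K) + (A + 8 * (P * K))
  rhs = solve-∀

initial-budget : ∀ n {p q N} → p * 2 ^ (n + 2) ≤ q → N * q + 4 * n * (p * N * 2) ≤ (N * q + p * N) * 2
initial-budget n {p} {q} {N} p2^[n+2]≤q = begin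
  N * q + 4 * n * (p * N * 2)   ≡⟨ cong (N * q +_) (regroup n p N) ⟩
  N * q + N * (p * (8 * n))     ≤⟨ +-monoʳ-≤ (N * q) (*-monoʳ-≤ N (≤-trans (*-monoʳ-≤ p (8*n≤2^[n+2] n)) p2^[n+2]≤q)) ⟩
  N * q + N * q                 ≤⟨ m≤m+n _ _ ⟩
  N * q + N * q + 2 * (p * N)   ≡⟨ expand N q p ⟩
  (N * q + p * N) * 2           ∎
  where
  open ≤-Reasoning
  regroup : ∀ n p N → 4 * n * (p * N * 2) ≡ N * (p * (8 * n))
  regroup = solve-∀
  expand : ∀ N q p → N * q + N * q + 2 * (p * N) ≡ (N * q + p * N) * 2
  expand = solve-∀

-- Finite sets

private variable
  n ℓ m : ℕ
  a u v w x : Fin n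
  p q H X Y : Subset n

∈-tabulate⁺ : ∀ (f : Fin n → Bool) → f x ≡ true → x ∈ tabulate f
∈-tabulate⁺ {x = x} f fx = lookup⇒[]= x (tabulate f) (trans (lookup∘tabulate f x) fx)

∈-tabulate⁻ : ∀ (f : Fin n → Bool) → x ∈ tabulate f → f x ≡ true
∈-tabulate⁻ {x = x} f x∈ = trans (sym (lookup∘tabulate f x)) ([]=⇒lookup x∈)

x∈p─q⇒x∉q : ∀ (p q : Subset n) → x ∈ p ─ q → x ∉ q
x∈p─q⇒x∉q (inside ∷ p) (outside ∷ q) here ()
x∈p─q⇒x∉q (_ ∷ p) (_ ∷ q) (there x∈p─q) (there x∈q) = x∈p─q⇒x∉q p q x∈p─q x∈q

p⊆q∪p─q : ∀ (p q : Subset n) → p ⊆ q ∪ (p ─ q)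
p⊆q∪p─q p q {x} x∈p with x ∈? q
... | yes x∈q = x∈p∪q⁺ (inj₁ x∈q)
... | no x∉q = x∈p∪q⁺ (inj₂ (x∈p∧x∉q⇒x∈p─q x∈p x∉q))

x∈p⇒0<∣p∣ : x ∈ p → 0 < ∣ p ∣
x∈p⇒0<∣p∣ x∈p = ≤-<-trans z≤n (x∈p⇒∣p-x∣<∣p∣ x∈p)

∣p∪q∣≤∣p∣+∣q∣ : ∀ (p q : Subset n) → ∣ p ∪ q ∣ ≤ ∣ p ∣ + ∣ q ∣
∣p∪q∣≤∣p∣+∣q∣ [] [] = z≤n
∣p∪q∣≤∣p∣+∣q∣ (inside ∷ p) (inside ∷ q) = s≤s (≤-trans (∣p∪q∣≤∣p∣+∣q∣ p q) (+-monoʳ-≤ ∣ p ∣ (n≤1+n ∣ q ∣)))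
∣p∪q∣≤∣p∣+∣q∣ (inside ∷ p) (outside ∷ q) = s≤s (∣p∪q∣≤∣p∣+∣q∣ p q)
∣p∪q∣≤∣p∣+∣q∣ (outside ∷ p) (inside ∷ q) = ≤-trans (s≤s (∣p∪q∣≤∣p∣+∣q∣ p q)) (≤-reflexive (sym (+-suc ∣ p ∣ ∣ q ∣)))
∣p∪q∣≤∣p∣+∣q∣ (outside ∷ p) (outside ∷ q) = ∣p∪q∣≤∣p∣+∣q∣ p q

∣p∣≡∣p∩q∣+∣p─q∣ : ∀ (p q : Subset n) → ∣ p ∣ ≡ ∣ p ∩ q ∣ + ∣ p ─ q ∣
∣p∣≡∣p∩q∣+∣p─q∣ [] [] = refl
∣p∣≡∣p∩q∣+∣p─q∣ (inside ∷ p) (inside ∷ q) = cong suc (∣p∣≡∣p∩q∣+∣p─q∣ p q)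
∣p∣≡∣p∩q∣+∣p─q∣ (inside ∷ p) (outside ∷ q) = trans (cong suc (∣p∣≡∣p∩q∣+∣p─q∣ p q)) (sym (+-suc ∣ p ∩ q ∣ ∣ p ─ q ∣))
∣p∣≡∣p∩q∣+∣p─q∣ (outside ∷ p) (inside ∷ q) = ∣p∣≡∣p∩q∣+∣p─q∣ p q
∣p∣≡∣p∩q∣+∣p─q∣ (outside ∷ p) (outside ∷ q) = ∣p∣≡∣p∩q∣+∣p─q∣ p q

∣p∣≤∣q∣+∣p─q∣ : ∀ (p q : Subset n) → ∣ p ∣ ≤ ∣ q ∣ + ∣ p ─ q ∣
∣p∣≤∣q∣+∣p─q∣ p q = ≤-trans (≤-reflexive (∣p∣≡∣p∩q∣+∣p─q∣ p q)) (+-monoˡ-≤ ∣ p ─ q ∣ (∣p∩q∣≤∣q∣ p q))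

∣q∣+∣p─q∣≤∣p∣ : ∀ (p q : Subset n) → q ⊆ p → ∣ q ∣ + ∣ p ─ q ∣ ≤ ∣ p ∣
∣q∣+∣p─q∣≤∣p∣ p q q⊆p = ≤-trans (+-monoˡ-≤ ∣ p ─ q ∣ (p⊆q⇒∣p∣≤∣q∣ (λ x∈q → x∈p∩q⁺ (q⊆p x∈q , x∈q))))
                                (≤-reflexive (sym (∣p∣≡∣p∩q∣+∣p─q∣ p q)))

∃-⊆-of-size : ∀ (p : Subset n) {t} → t ≤ ∣ p ∣ → ∃[ q ] (q ⊆ p × ∣ q ∣ ≡ t)
∃-⊆-of-size {n} p {zero} _ = ⊥ , ⊥⊆ , ∣⊥∣≡0 n
∃-⊆-of-size (outside ∷ p) {suc t} t<∣p∣ with ∃-⊆-of-size p t<∣p∣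
... | q , q⊆p , ∣q∣≡t = outside ∷ q , out⊆ q⊆p , ∣q∣≡t
∃-⊆-of-size (inside ∷ p) {suc t} (s≤s t≤∣p∣) with ∃-⊆-of-size p t≤∣p∣
... | q , q⊆p , ∣q∣≡t = inside ∷ q , in⊆in q⊆p , cong suc ∣q∣≡t

∣p∣≤1⇒p⊆⁅x⁆ : ∣ p ∣ ≤ 1 → x ∈ p → p ⊆ ⁅ x ⁆
∣p∣≤1⇒p⊆⁅x⁆ {x = x} ∣p∣≤1 x∈p {y} y∈p with y Finₚ.≟ x
... | yes refl = x∈⁅x⁆ x
... | no y≢x = contradiction ∣p∣≤1 (<⇒≱ (≤-<-trans (x∈p⇒0<∣p∣ (x∈p∧x≢y⇒x∈p-y y∈p y≢x)) (x∈p⇒∣p-x∣<∣p∣ x∈p)))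

0<∣p∣⇒Nonempty : 0 < ∣ p ∣ → Nonempty p
0<∣p∣⇒Nonempty {n} {p} 0<∣p∣ with nonempty? p
... | yes nonempty = nonempty
... | no empty = contradiction (trans (cong ∣_∣ (Empty-unique empty)) (∣⊥∣≡0 n)) (>⇒≢ 0<∣p∣)

∃-⁅⁆-cover : ∣ p ∣ ≤ 1 → p ⊆ q → Nonempty q → ∃[ x ] (x ∈ q × p ⊆ ⁅ x ⁆)
∃-⁅⁆-cover {p = p} ∣p∣≤1 p⊆q (y , y∈q) with nonempty? p
... | yes (x , x∈p) = x , p⊆q x∈p , ∣p∣≤1⇒p⊆⁅x⁆ ∣p∣≤1 x∈p
... | no empty = y , y∈q , λ x∈p → contradiction (_ , x∈p) empty

initial : ℕ → Subset n
initial c = tabulate (λ i → toℕ i <ᵇ c)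

x∉initial[0] : x ∉ initial {n} 0
x∉initial[0] {x = x} x∈ with ∈-tabulate⁻ (λ i → toℕ i <ᵇ 0) x∈
... | ()

x∈initial[n] : ∀ {n} {x : Fin n} → x ∈ initial n
x∈initial[n] {n} {x} = ∈-tabulate⁺ (λ i → toℕ i <ᵇ n) (Equivalence.to T-≡ (<⇒<ᵇ (toℕ<n x)))

x∈initial[1+c] : ∀ {c} → x ∈ initial {n} (suc c) → x ∈ initial c ⊎ toℕ x ≡ c
x∈initial[1+c] {x = x} {c} x∈ with m≤n⇒m<n∨m≡n (s≤s⁻¹ (<ᵇ⇒< (toℕ x) (suc c) (Equivalence.from T-≡ (∈-tabulate⁻ (λ i → toℕ i <ᵇ suc c) x∈))))
... | inj₁ x<c = inj₁ (∈-tabulate⁺ (λ i → toℕ i <ᵇ c) (Equivalence.to T-≡ (<⇒<ᵇ x<c)))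
... | inj₂ x≡c = inj₂ x≡c

chain : Subset n → Subset n → ℕ → Subset n
chain S T c = S ∪ (T ∩ initial c)

chain-0 : ∀ (S T : Subset n) → chain S T 0 ⊆ S
chain-0 S T x∈ with x∈p∪q⁻ S _ x∈
... | inj₁ x∈S = x∈S
... | inj₂ x∈T∩ = contradiction (proj₂ (x∈p∩q⁻ T _ x∈T∩)) x∉initial[0]

T⊆chain-n : ∀ (S T : Subset n) → T ⊆ chain S T n
T⊆chain-n S T x∈T = x∈p∪q⁺ (inj₂ (x∈p∩q⁺ (x∈T , x∈initial[n])))

chain⊆T : ∀ {S T : Subset n} c → S ⊆ T → chain S T c ⊆ T
chain⊆T {S = S} {T} c S⊆T x∈ = [ S⊆T , proj₁ ∘ x∈p∩q⁻ T _ ] (x∈p∪q⁻ S _ x∈)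

chain-step : ∀ (S T : Subset n) {c} (c<n : c < n) → x ∈ chain S T (suc c) →
  x ∈ chain S T c ⊎ (x ≡ fromℕ< c<n × x ∈ T)
chain-step S T {c} c<n x∈ with x∈p∪q⁻ S _ x∈
... | inj₁ x∈S = inj₁ (x∈p∪q⁺ (inj₁ x∈S))
... | inj₂ x∈T∩ with x∈p∩q⁻ T _ x∈T∩
...   | x∈T , x∈init with x∈initial[1+c] x∈init
...     | inj₁ x∈initc = inj₁ (x∈p∪q⁺ (inj₂ (x∈p∩q⁺ (x∈T , x∈initc))))
...     | inj₂ x≡c = inj₂ (toℕ-injective (trans x≡c (sym (toℕ-fromℕ< c<n))) , x∈T)

crossing-⊆ : ∀ {Q : Subset n → Set} → Decidable Q → (∀ {X Y} → X ⊆ Y → Q X → Q Y) →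
  ∀ {S T} → S ⊆ T → ¬ Q S → Q T →
  ∃[ X ] ∃[ v ] (S ⊆ X × X ⊆ T × v ∈ T × ¬ Q X × Q (X ∪ ⁅ v ⁆))
crossing-⊆ Q? mono {S} {T} S⊆T ¬QS QT
  with crossing (λ c → Q? (chain S T c)) (¬QS ∘ mono (chain-0 S T)) (mono (T⊆chain-n S T) QT)
... | c , c<n , ¬Qc , Q1+c with fromℕ< c<n ∈? T
...   | yes v∈T = chain S T c , fromℕ< c<n , p⊆p∪q _ , chain⊆T c S⊆T , v∈T , ¬Qc , mono added-v Q1+c
  where
  added-v : chain S T (suc c) ⊆ chain S T c ∪ ⁅ fromℕ< c<n ⁆
  added-v x∈ with chain-step S T c<n x∈
  ... | inj₁ x∈chain = x∈p∪q⁺ (inj₁ x∈chain)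
  ... | inj₂ (refl , _) = x∈p∪q⁺ (inj₂ (x∈⁅x⁆ _))
...   | no v∉T = contradiction (mono nothing-added Q1+c) ¬Qc
  where
  nothing-added : chain S T (suc c) ⊆ chain S T c
  nothing-added x∈ with chain-step S T c<n x∈
  ... | inj₁ x∈chain = x∈chain
  ... | inj₂ (refl , v∈T) = contradiction v∈T v∉T

subadditive-bound : ∀ {S : Subset n} (f : Subset n → Subset n) →
  (∀ {X Y} → X ⊆ Y → f X ⊆ f Y) → (∀ X Y → f (X ∪ Y) ⊆ f X ∪ f Y) →
  ∀ {M z b} → (∀ {X} → X ⊆ S → ∣ X ∣ ≤ M → ∣ f X ∣ * z < b) →
  ∀ r {X} → 0 < r → X ⊆ S → ∣ X ∣ ≤ r * M → ∣ f X ∣ * z < r * b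
subadditive-bound {S = S} f mono f-∪ {M} {z} {b} bound (suc r) _ = go r
  where
  go : ∀ r {X} → X ⊆ S → ∣ X ∣ ≤ suc r * M → ∣ f X ∣ * z < suc r * b
  go zero X⊆S ∣X∣≤M+0 =
    <-≤-trans (bound X⊆S (≤-trans ∣X∣≤M+0 (≤-reflexive (+-identityʳ M)))) (≤-reflexive (sym (+-identityʳ b)))
  go (suc r) {X} X⊆S ∣X∣≤ with ∣ X ∣ ≤? M
  ... | yes ∣X∣≤M = <-≤-trans (bound X⊆S ∣X∣≤M) (m≤m+n b _)
  ... | no ∣X∣≰M with ∃-⊆-of-size X (<⇒≤ (≰⇒> ∣X∣≰M))
  ...   | T , T⊆X , ∣T∣≡M = begin-strict
    ∣ f X ∣ * z                      ≤⟨ *-monoˡ-≤ z (≤-trans (p⊆q⇒∣p∣≤∣q∣ f-split) (∣p∪q∣≤∣p∣+∣q∣ (f T) (f (X ─ T)))) ⟩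
    (∣ f T ∣ + ∣ f (X ─ T) ∣) * z    ≡⟨ *-distribʳ-+ z ∣ f T ∣ _ ⟩
    ∣ f T ∣ * z + ∣ f (X ─ T) ∣ * z  <⟨ +-mono-< (bound (X⊆S ∘ T⊆X) (≤-reflexive ∣T∣≡M)) (go r (X⊆S ∘ p─q⊆p X T) ∣X─T∣≤) ⟩
    b + suc r * b                    ∎
    where
    open ≤-Reasoning
    f-split : f X ⊆ f T ∪ f (X ─ T)
    f-split = f-∪ T (X ─ T) ∘ mono (p⊆q∪p─q X T)
    ∣X─T∣≤ : ∣ X ─ T ∣ ≤ suc r * M
    ∣X─T∣≤ = +-cancelˡ-≤ M _ _ (≤-trans (≤-reflexive (cong (_+ ∣ X ─ T ∣) (sym ∣T∣≡M)))
                                        (≤-trans (∣q∣+∣p─q∣≤∣p∣ X T T⊆X) ∣X∣≤))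

-- Walks and paths

Adj-sym : ∀ {N} (G : Graph N) {u v} → Adj G u v → Adj G v u
Adj-sym G {u} {v} uv = trans (Graph.sym G v u) uv

module _ {N : ℕ} {G : Graph N} where

  end∈ : WalkIn G H u v ℓ → v ∈ H
  end∈ (here v∈H) = v∈H
  end∈ (step _ _ walk) = end∈ walk

  snoc : WalkIn G H u v ℓ → Adj G v w → w ∈ H → WalkIn G H u w (suc ℓ)
  snoc (here v∈H) vw w∈H = step v∈H vw (here w∈H)
  snoc (step u∈H uu' walk) vw w∈H = step u∈H uu' (snoc walk vw w∈H)

  reverse : WalkIn G H u v ℓ → WalkIn G H v u ℓ
  reverse (here v∈H) = here v∈H
  reverse (step u∈H uw walk) = snoc (reverse walk) (Adj-sym G uw) u∈H

  _++ʷ_ : WalkIn G H u v ℓ → WalkIn G H v w m → WalkIn G H u w (ℓ + m)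
  here _ ++ʷ walk' = walk'
  step u∈H uu' walk ++ʷ walk' = step u∈H uu' (walk ++ʷ walk')

  suffixFrom : ∀ u (path : WalkIn G H x v ℓ) → Unique (verts G path) →
    (∃[ ℓ' ] (ℓ' ≤ ℓ × PathIn G H u v ℓ')) ⊎ All (u ≢_) (verts G path)
  suffixFrom u (here {x} x∈H) unique with u Finₚ.≟ x
  ... | yes refl = inj₁ (0 , z≤n , here x∈H , unique)
  ... | no u≢x = inj₂ (u≢x ∷ [])
  suffixFrom u (step {x} x∈H xy path) unique with u Finₚ.≟ x
  ... | yes refl = inj₁ (_ , ≤-refl , step x∈H xy path , unique)
  suffixFrom u (step {x} x∈H xy path) (_ ∷ unique) | no u≢x with suffixFrom u path unique
  ... | inj₁ (ℓ' , ℓ'≤ℓ , suffix) = inj₁ (ℓ' , m≤n⇒m≤1+n ℓ'≤ℓ , suffix)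
  ... | inj₂ u∉path = inj₂ (u≢x ∷ u∉path)

  walk⇒path : WalkIn G H u v ℓ → ∃[ ℓ' ] (ℓ' ≤ ℓ × PathIn G H u v ℓ')
  walk⇒path (here v∈H) = 0 , z≤n , here v∈H , [] ∷ []
  walk⇒path (step {u} u∈H uw walk) with walk⇒path walk
  ... | ℓ' , ℓ'≤ℓ , path , unique with suffixFrom u path unique
  ...   | inj₁ (ℓ'' , ℓ''≤ℓ' , shortcut) = ℓ'' , m≤n⇒m≤1+n (≤-trans ℓ''≤ℓ' ℓ'≤ℓ) , shortcut
  ...   | inj₂ u∉path = suc ℓ' , s≤s ℓ'≤ℓ , step u∈H uw path , u∉path ∷ unique

-- Neighbourhoods in G[W]

module _ {N : ℕ} (G : Graph N) where

  Adj? : ∀ u v → Dec (Adj G u v)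
  Adj? u v = E G u v Boolₚ.≟ true

  adjacentTo : Subset N → Subset N
  adjacentTo X = tabulate λ u → ⌊ any? (λ x → x ∈? X ×-dec Adj? x u) ⌋

  ∈adjacentTo⁺ : x ∈ X → Adj G x u → u ∈ adjacentTo X
  ∈adjacentTo⁺ {x} x∈X xu = ∈-tabulate⁺ _ (Equivalence.to T-≡ (fromWitness (x , x∈X , xu)))

  ∈adjacentTo⁻ : u ∈ adjacentTo X → ∃[ x ] (x ∈ X × Adj G x u)
  ∈adjacentTo⁻ u∈ = toWitness (Equivalence.from T-≡ (∈-tabulate⁻ _ u∈))

  module Within (W : Subset N) where

    closedNbhd : Subset N → Subset N
    closedNbhd X = W ∩ (X ∪ adjacentTo X)

    closedNbhd⊆W : closedNbhd X ⊆ W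
    closedNbhd⊆W = p∩q⊆p W _

    X⊆closedNbhd : X ⊆ W → X ⊆ closedNbhd X
    X⊆closedNbhd X⊆W x∈X = x∈p∩q⁺ (X⊆W x∈X , x∈p∪q⁺ (inj₁ x∈X))

    ∈closedNbhd⁺ : x ∈ X → Adj G x u → u ∈ W → u ∈ closedNbhd X
    ∈closedNbhd⁺ x∈X xu u∈W = x∈p∩q⁺ (u∈W , x∈p∪q⁺ (inj₂ (∈adjacentTo⁺ x∈X xu)))

    ∈closedNbhd⁻ : u ∈ closedNbhd X → u ∈ X ⊎ ∃[ x ] (x ∈ X × Adj G x u)
    ∈closedNbhd⁻ {X = X} u∈ with x∈p∪q⁻ X _ (proj₂ (x∈p∩q⁻ W _ u∈))
    ... | inj₁ u∈X = inj₁ u∈X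
    ... | inj₂ u∈adjacentTo = inj₂ (∈adjacentTo⁻ u∈adjacentTo)

    closedNbhd-mono : X ⊆ Y → closedNbhd X ⊆ closedNbhd Y
    closedNbhd-mono X⊆Y u∈ with ∈closedNbhd⁻ u∈
    ... | inj₁ u∈X = x∈p∩q⁺ (closedNbhd⊆W u∈ , x∈p∪q⁺ (inj₁ (X⊆Y u∈X)))
    ... | inj₂ (x , x∈X , xu) = ∈closedNbhd⁺ (X⊆Y x∈X) xu (closedNbhd⊆W u∈)

    closedNbhd-∪ : ∀ X Y → closedNbhd (X ∪ Y) ⊆ closedNbhd X ∪ closedNbhd Y
    closedNbhd-∪ X Y u∈ with ∈closedNbhd⁻ u∈
    ... | inj₁ u∈X∪Y with x∈p∪q⁻ X Y u∈X∪Y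
    ...   | inj₁ u∈X = x∈p∪q⁺ (inj₁ (x∈p∩q⁺ (closedNbhd⊆W u∈ , x∈p∪q⁺ (inj₁ u∈X))))
    ...   | inj₂ u∈Y = x∈p∪q⁺ (inj₂ (x∈p∩q⁺ (closedNbhd⊆W u∈ , x∈p∪q⁺ (inj₁ u∈Y))))
    closedNbhd-∪ X Y u∈ | inj₂ (x , x∈X∪Y , xu) with x∈p∪q⁻ X Y x∈X∪Y
    ...   | inj₁ x∈X = x∈p∪q⁺ (inj₁ (∈closedNbhd⁺ x∈X xu (closedNbhd⊆W u∈)))
    ...   | inj₂ x∈Y = x∈p∪q⁺ (inj₂ (∈closedNbhd⁺ x∈Y xu (closedNbhd⊆W u∈)))

    closedNbhd-⊥ : closedNbhd ⊥ ⊆ ⊥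
    closedNbhd-⊥ u∈ with ∈closedNbhd⁻ u∈
    ... | inj₁ u∈⊥ = u∈⊥
    ... | inj₂ (x , x∈⊥ , _) = contradiction x∈⊥ ∉⊥

    closedNbhd-⁅⁆ : closedNbhd ⁅ v ⁆ ⊆ ⁅ v ⁆ ∪ nbhd G v
    closedNbhd-⁅⁆ {v} u∈ with ∈closedNbhd⁻ u∈
    ... | inj₁ u∈⁅v⁆ = x∈p∪q⁺ (inj₁ u∈⁅v⁆)
    ... | inj₂ (x , x∈⁅v⁆ , xu) with x∈⁅y⁆⇒x≡y v x∈⁅v⁆
    ...   | refl = x∈p∪q⁺ (inj₂ (∈-tabulate⁺ _ xu))

    closedNbhd^ : ℕ → Subset N → Subset N
    closedNbhd^ zero X = X
    closedNbhd^ (suc j) X = closedNbhd (closedNbhd^ j X)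

    closedNbhd^-mono : ∀ j → X ⊆ Y → closedNbhd^ j X ⊆ closedNbhd^ j Y
    closedNbhd^-mono zero X⊆Y = X⊆Y
    closedNbhd^-mono (suc j) X⊆Y = closedNbhd-mono (closedNbhd^-mono j X⊆Y)

    closedNbhd^-∪ : ∀ j X Y → closedNbhd^ j (X ∪ Y) ⊆ closedNbhd^ j X ∪ closedNbhd^ j Y
    closedNbhd^-∪ zero X Y u∈ = u∈
    closedNbhd^-∪ (suc j) X Y = closedNbhd-∪ _ _ ∘ closedNbhd-mono (closedNbhd^-∪ j X Y)

    closedNbhd^⊆W : ∀ j → X ⊆ W → closedNbhd^ j X ⊆ W
    closedNbhd^⊆W zero X⊆W = X⊆W
    closedNbhd^⊆W (suc j) _ = closedNbhd⊆W

    -- ball a r: vertices joined to a by a walk of G[W] with fewer than r edges.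
    ball : Fin N → ℕ → Subset N
    ball a zero = ⊥
    ball a (suc r) = closedNbhd^ r ⁅ a ⁆

    ball⊆W : a ∈ W → ∀ r → ball a r ⊆ W
    ball⊆W a∈W zero = ⊥⊆
    ball⊆W a∈W (suc r) = closedNbhd^⊆W r λ u∈⁅a⁆ → subst (_∈ W) (sym (x∈⁅y⁆⇒x≡y _ u∈⁅a⁆)) a∈W

    ball-step : a ∈ W → ∀ r → ball a r ⊆ ball a (suc r)
    ball-step a∈W zero = ⊥⊆
    ball-step a∈W (suc r) = X⊆closedNbhd (ball⊆W a∈W (suc r))

    walk-to-centre : a ∈ W → ∀ m → ball a m ⊆ H → u ∈ ball a (suc m) → u ∈ H →
      ∃[ ℓ ] (ℓ ≤ m × WalkIn G H u a ℓ)
    walk-to-centre {a = a} a∈W zero _ u∈⁅a⁆ u∈H with x∈⁅y⁆⇒x≡y a u∈⁅a⁆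
    ... | refl = 0 , z≤n , here u∈H
    walk-to-centre a∈W (suc m) ball⊆H u∈ u∈H with ∈closedNbhd⁻ u∈
    ... | inj₁ u∈ball with walk-to-centre a∈W m (ball⊆H ∘ ball-step a∈W m) u∈ball u∈H
    ...   | ℓ , ℓ≤m , walk = ℓ , m≤n⇒m≤1+n ℓ≤m , walk
    walk-to-centre a∈W (suc m) ball⊆H u∈ u∈H | inj₂ (x , x∈ball , xu)
      with walk-to-centre a∈W m (ball⊆H ∘ ball-step a∈W m) x∈ball (ball⊆H x∈ball)
    ...   | ℓ , ℓ≤m , walk = suc ℓ , s≤s ℓ≤m , step u∈H (Adj-sym G xu) walk

    module _ {a} (a∈W : a ∈ W) (j : ℕ) {H} (ball⊆H : ball a j ⊆ H) (H⊆ball : H ⊆ ball a (suc j)) where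

      walk-to-centreIn : u ∈ H → ∃[ ℓ ] (ℓ ≤ j × WalkIn G H u a ℓ)
      walk-to-centreIn u∈H = walk-to-centre a∈W j ball⊆H (H⊆ball u∈H) u∈H

      layerCovering : Nonempty H → Covering G
      layerCovering (u , u∈H) = record
        { apex = a
        ; heart = H
        ; base = closedNbhd H ─ H
        ; disjHB = λ x x∈H x∈base → x∈p─q⇒x∉q _ H x∈base x∈H
        ; apex∈ = end∈ (proj₂ (proj₂ (walk-to-centreIn u∈H)))
        ; covers = base-covered
        ; connected = H-connected
        }
        where
        base-covered : Covers G H (closedNbhd H ─ H)
        base-covered x x∈base with ∈closedNbhd⁻ (p─q⊆p _ H x∈base)
        ... | inj₁ x∈H = contradiction x∈H (x∈p─q⇒x∉q _ H x∈base)
        ... | inj₂ neighbour = neighbour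
        H-connected : ConnectedIn G H
        H-connected x y x∈H y∈H with walk-to-centreIn x∈H | walk-to-centreIn y∈H
        ... | _ , _ , x→a | _ , _ , y→a with walk⇒path (x→a ++ʷ reverse y→a)
        ...   | ℓ , _ , path = ℓ , path

      layerCovering-height : ∀ {r} → j < r → (ne : Nonempty H) → HeightAtMost G r (layerCovering ne)
      layerCovering-height j<r _ v v∈H with walk-to-centreIn v∈H
      ... | ℓ , ℓ≤j , v→a with walk⇒path (reverse v→a)
      ...   | ℓ' , ℓ'≤ℓ , path = ℓ' , ≤-trans (s≤s (≤-trans ℓ'≤ℓ ℓ≤j)) j<r , path

    remote : Subset N → Subset N
    remote X = W ─ closedNbhd X

    remote⊆W : remote X ⊆ W
    remote⊆W = p─q⊆p W _

    remote-disjoint : X ⊆ W → Disjoint G X (remote X)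
    remote-disjoint X⊆W v v∈X v∈remote = x∈p─q⇒x∉q W _ v∈remote (X⊆closedNbhd X⊆W v∈X)

    remote-anticomplete : Anticomplete G X (remote X)
    remote-anticomplete u v u∈X v∈remote uv =
      x∈p─q⇒x∉q W _ v∈remote (∈closedNbhd⁺ u∈X uv (remote⊆W v∈remote))

    ∣W∣≤∣closedNbhd∣+∣remote∣ : ∀ X → ∣ W ∣ ≤ ∣ closedNbhd X ∣ + ∣ remote X ∣
    ∣W∣≤∣closedNbhd∣+∣remote∣ X = ∣p∣≤∣q∣+∣p─q∣ W (closedNbhd X)

-- Coverings in coherent sparse graphs

module _ {N : ℕ} (G : Graph N) (k' p q : ℕ) (coherent : Coherent G (suc k') p q) where

  εN¹⁻ᶜ≤ : Subset N → Set
  εN¹⁻ᶜ≤ X = p ^ suc k' * N ^ k' ≤ ∣ X ∣ ^ suc k' * q ^ suc k'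

  εN¹⁻ᶜ≤? : Decidable εN¹⁻ᶜ≤
  εN¹⁻ᶜ≤? X = _ ≤? _

  εN≤ : Subset N → Set
  εN≤ X = p * N ≤ ∣ X ∣ * q

  separation : ∀ {W X} → X ⊆ W → εN¹⁻ᶜ≤ X → ¬ εN≤ (Within.remote G W X)
  separation {W} X⊆W = coherent _ _ (remote-disjoint X⊆W) remote-anticomplete
    where open Within G W

  module BallLemma (ρ : ℕ) (1≤ρ : 1 ≤ ρ) (ρ^k≤N : ρ ^ suc k' ≤ N) (N<[1+ρ]^k : N < suc ρ ^ suc k')
    (2p≤q : 2 * p ≤ q) (0<pN : 0 < p * N)
    (W : Subset N) (3εN≤∣W∣ : 3 * (p * N) ≤ ∣ W ∣ * q) where

    open Within G W

    <εN/ρ : Subset N → Set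
    <εN/ρ X = ∣ X ∣ * (q * ρ) < p * N

    ¬εN¹⁻ᶜ≤⇒<εN/ρ : ∀ {X} → ¬ εN¹⁻ᶜ≤ X → <εN/ρ X
    ¬εN¹⁻ᶜ≤⇒<εN/ρ {X} ¬big = ≰⇒> (¬big ∘ εN/ρ≤⇒εN¹⁻ᶜ≤ k' {p} {q} ∣ X ∣ 0<N ρ^k≤N)
      where
      0<N : 0 < N
      0<N = ≤-trans (m^n>0 ρ {{>-nonZero 1≤ρ}} (suc k')) ρ^k≤N

    W-nonempty : Nonempty W
    W-nonempty = 0<∣p∣⇒Nonempty (n≢0⇒n>0 λ ∣W∣≡0 →
      <⇒≱ 0<3pN (subst (λ w → 3 * (p * N) ≤ w * q) ∣W∣≡0 3εN≤∣W∣))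
      where
      0<3pN : 0 < 3 * (p * N)
      0<3pN = ≤-trans 0<pN (m≤n*m (p * N) 3)

    module _ (balls-thin : ∀ {a} → a ∈ W → ¬ εN¹⁻ᶜ≤ (ball a (suc k'))) where

      closedNbhd^-thin : ∀ m j → j + m ≡ k' → ∀ {S} → S ⊆ W → ∣ S ∣ ≤ (2 * ρ) ^ m →
        <εN/ρ (closedNbhd^ j S)
      closedNbhd^-thin zero j j+0≡k' S⊆W ∣S∣≤1 with ∃-⁅⁆-cover ∣S∣≤1 S⊆W W-nonempty
      ... | a , a∈W , S⊆⁅a⁆ =
        ≤-<-trans (*-monoˡ-≤ (q * ρ) (p⊆q⇒∣p∣≤∣q∣ (closedNbhd^-mono j S⊆⁅a⁆)))
                  (¬εN¹⁻ᶜ≤⇒<εN/ρ {ball a (suc j)} (subst (λ i → ¬ εN¹⁻ᶜ≤ (ball a (suc i))) k'≡j (balls-thin a∈W)))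
        where
        k'≡j : k' ≡ j
        k'≡j = trans (sym j+0≡k') (+-identityʳ j)
      closedNbhd^-thin (suc m) j j+1+m≡k' {S} S⊆W ∣S∣≤ =
        ¬εN¹⁻ᶜ≤⇒<εN/ρ {layer} λ thick → separation layer⊆W thick remote-large
        where
        layer = closedNbhd^ j S
        layer⊆W : layer ⊆ W
        layer⊆W = closedNbhd^⊆W j S⊆W
        next-thin : ∣ closedNbhd layer ∣ * (q * ρ) < 2 * ρ * (p * N)
        next-thin = subadditive-bound (closedNbhd^ (suc j)) (closedNbhd^-mono (suc j)) (closedNbhd^-∪ (suc j))
                  (closedNbhd^-thin m (suc j) (trans (sym (+-suc j m)) j+1+m≡k')) (2 * ρ)
                  (≤-trans 1≤ρ (m≤n*m ρ 2)) S⊆W ∣S∣≤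
        next<2εN : ∣ closedNbhd layer ∣ * q < 2 * (p * N)
        next<2εN = *-cancelʳ-< ρ _ _ (subst₂ _<_ (sym (*-assoc ∣ closedNbhd layer ∣ q ρ)) (swap ρ (p * N)) next-thin)
          where
          swap : ∀ a b → 2 * a * b ≡ 2 * b * a
          swap = solve-∀
        remote-large : εN≤ (remote layer)
        remote-large = large-remainder 0 {o = ∣ remote layer ∣} 3εN≤∣W∣ (∣W∣≤∣closedNbhd∣+∣remote∣ layer) next<2εN

      no-thick-ball : Empty.⊥
      no-thick-ball with (2 * ρ) ^ k' ≤? ∣ W ∣
      ... | yes fits with ∃-⊆-of-size W fits
      ...   | T , T⊆W , ∣T∣≡ = <⇒≱ T-thin (p*N≤[2ρ]^k'*[q*ρ] k' {p} {q} 1≤ρ N<[1+ρ]^k 2p≤q)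
        where
        T-thin : (2 * ρ) ^ k' * (q * ρ) < p * N
        T-thin = subst (λ t → t * (q * ρ) < p * N) ∣T∣≡ (closedNbhd^-thin k' 0 refl T⊆W (≤-reflexive ∣T∣≡))
      no-thick-ball | no too-big = <⇒≱ (closedNbhd^-thin k' 0 refl ⊆-refl (<⇒≤ (≰⇒> too-big))) εN≤∣W∣qρ
        where
        εN≤∣W∣qρ : p * N ≤ ∣ W ∣ * (q * ρ)
        εN≤∣W∣qρ = ≤-trans (m≤n*m (p * N) 3) (≤-trans 3εN≤∣W∣ (*-monoʳ-≤ ∣ W ∣ (m≤m*n q ρ {{>-nonZero 1≤ρ}})))

    ∃-thick-ball : ∃[ a ] (a ∈ W × εN¹⁻ᶜ≤ (ball a (suc k')))
    ∃-thick-ball with any? (λ a → a ∈? W ×-dec εN¹⁻ᶜ≤? (ball a (suc k')))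
    ... | yes thick = thick
    ... | no none = ⊥-elim (no-thick-ball (λ a∈W thick → none (_ , a∈W , thick)))

  coherent⇒1<εN : Sparse G p q → 1 < N → q < p * N
  coherent⇒1<εN sparse 1<N = ≰⇒> λ pN≤q →
    coherent ⁅ v₀ ⁆ (∁ ⁅ v₀ ⁆) disjoint (λ u v _ _ → no-edge pN≤q u v) (thick pN≤q) (large pN≤q)
    where
    0<N : 0 < N
    0<N = <-trans z<s 1<N
    v₀ : Fin N
    v₀ = fromℕ< 0<N
    pN≤1*q : p * N ≤ q → p * N ≤ 1 * q
    pN≤1*q = subst (p * N ≤_) (sym (*-identityˡ q))
    disjoint : Disjoint G ⁅ v₀ ⁆ (∁ ⁅ v₀ ⁆)
    disjoint v v∈⁅v₀⁆ v∈∁⁅v₀⁆ = x∈∁p⇒x∉p v∈∁⁅v₀⁆ v∈⁅v₀⁆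
    no-edge : p * N ≤ q → ∀ u v → ¬ Adj G u v
    no-edge pN≤q u v uv = <⇒≱ (x∈p⇒0<∣p∣ (∈-tabulate⁺ (E G u) uv))
      (s≤s⁻¹ (*-cancelʳ-< q _ 1 (<-≤-trans (sparse u) (pN≤1*q pN≤q))))
    thick : p * N ≤ q → εN¹⁻ᶜ≤ ⁅ v₀ ⁆
    thick pN≤q = εN≤⇒εN¹⁻ᶜ≤ k' {p} {q} ∣ ⁅ v₀ ⁆ ∣ 0<N
      (subst (λ s → p * N ≤ s * q) (sym (∣⁅x⁆∣≡1 v₀)) (pN≤1*q pN≤q))
    1≤∣∁⁅v₀⁆∣ : 1 ≤ ∣ ∁ ⁅ v₀ ⁆ ∣
    1≤∣∁⁅v₀⁆∣ = subst (1 ≤_) (sym (trans (∣∁p∣≡n∸∣p∣ ⁅ v₀ ⁆) (cong (N ∸_) (∣⁅x⁆∣≡1 v₀)))) (m<n⇒0<n∸m 1<N)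
    large : p * N ≤ q → εN≤ (∁ ⁅ v₀ ⁆)
    large pN≤q = ≤-trans (pN≤1*q pN≤q) (*-monoˡ-≤ q 1≤∣∁⁅v₀⁆∣)

  record CoveringSequenceIn (W : Subset N) (n K : ℕ) : Set where
    field
      L          : Fin n → Covering G
      sequence   : IsCoveringSequence G L
      ordered    : ∀ i j → i Fin.< j → Anticomplete G (heart (L i)) (base (L j))
      height     : ∀ i → HeightAtMost G (suc k') (L i)
      base-large : ∀ i → N ≤ ∣ base (L i) ∣ * (2 ^ toℕ i * K)
      heart⊆W    : ∀ i → heart (L i) ⊆ W
      base⊆W     : ∀ i → base (L i) ⊆ W

  module Stage (sparse : Sparse G p q) (1<εN : q < p * N) (K : ℕ) (0<K : 0 < K)
    (W : Subset N) (budget : N * q + 3 * (p * N * K) ≤ ∣ W ∣ * (q * K)) where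

    open Within G W

    -- |N[X]| ≥ N/K + 2εN, multiplied through by qK.
    LargeNbhd : Subset N → Set
    LargeNbhd X = N * q + 2 * (p * N * K) ≤ ∣ closedNbhd X ∣ * (q * K)

    LargeNbhd? : Decidable LargeNbhd
    LargeNbhd? X = _ ≤? _

    LargeNbhd-mono : ∀ {X Y} → X ⊆ Y → LargeNbhd X → LargeNbhd Y
    LargeNbhd-mono X⊆Y large = ≤-trans large (*-monoˡ-≤ (q * K) (p⊆q⇒∣p∣≤∣q∣ (closedNbhd-mono X⊆Y)))

    0<N : 0 < N
    0<N = n≢0⇒n>0 λ N≡0 → <⇒≱ 1<εN (≤-trans (≤-reflexive (trans (cong (p *_) N≡0) (*-zeroʳ p))) z≤n)

    scale : ∀ x {y} → x * q < y → x * (q * K) < y * K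
    scale x {y} xq<y = subst (_< y * K) (*-assoc x q K) (*-monoˡ-< K {{>-nonZero 0<K}} xq<y)

    scale₂ : ∀ x → x * q < 2 * (p * N) → x * (q * K) < 2 * (p * N * K)
    scale₂ x xq<2pN = subst (x * (q * K) <_) (*-assoc 2 (p * N) K) (scale x xq<2pN)

    ¬LargeNbhd-⊥ : ¬ LargeNbhd ⊥
    ¬LargeNbhd-⊥ large = <⇒≱ 0<2pNK (≤-trans (m≤n+m _ (N * q)) (≤-trans large ∣N[⊥]∣qK≤0))
      where
      0<2pNK : 0 < 2 * (p * N * K)
      0<2pNK = ≤-trans (scale 0 (≤-<-trans z≤n 1<εN)) (m≤n*m (p * N * K) 2)
      ∣N[⊥]∣≤0 : ∣ closedNbhd ⊥ ∣ ≤ 0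
      ∣N[⊥]∣≤0 = ≤-trans (p⊆q⇒∣p∣≤∣q∣ closedNbhd-⊥) (≤-reflexive (∣⊥∣≡0 N))
      ∣N[⊥]∣qK≤0 : ∣ closedNbhd ⊥ ∣ * (q * K) ≤ 0
      ∣N[⊥]∣qK≤0 = ≤-reflexive (cong (_* (q * K)) (n≤0⇒n≡0 ∣N[⊥]∣≤0))

    thick⇒LargeNbhd : ∀ {X} → X ⊆ W → εN¹⁻ᶜ≤ X → LargeNbhd X
    thick⇒LargeNbhd {X} X⊆W thick =
      large-part (N * q) {y = ∣ closedNbhd X ∣} {∣ remote X ∣} budget (∣W∣≤∣closedNbhd∣+∣remote∣ X)
        (scale ∣ remote X ∣ (≰⇒> (separation X⊆W thick)))

    ¬LargeNbhd⇒<εN : ∀ {X} → X ⊆ W → ¬ LargeNbhd X → ∣ X ∣ * q < p * N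
    ¬LargeNbhd⇒<εN {X} X⊆W ¬large =
      ≰⇒> λ εN≤X → separation X⊆W (εN≤⇒εN¹⁻ᶜ≤ k' {p} {q} ∣ X ∣ 0<N εN≤X) remote-large
      where
      pNK≤∣remote∣qK : p * N * K ≤ ∣ remote X ∣ * (q * K)
      pNK≤∣remote∣qK = large-remainder (N * q) {y = ∣ closedNbhd X ∣} {∣ remote X ∣} budget
                         (∣W∣≤∣closedNbhd∣+∣remote∣ X) (≰⇒> ¬large)
      remote-large : εN≤ (remote X)
      remote-large = *-cancelʳ-≤ _ _ K {{>-nonZero 0<K}}
        (≤-trans pNK≤∣remote∣qK (≤-reflexive (sym (*-assoc ∣ remote X ∣ q K))))

    record Outcome : Set where
      field
        covering     : Covering G
        heart⊆W      : heart covering ⊆ W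
        base⊆W       : base covering ⊆ W
        height       : HeightAtMost G (suc k') covering
        base-large   : N ≤ ∣ base covering ∣ * K
        remote-large : ∣ W ∣ * (q * K) < N * q + 4 * (p * N * K) + ∣ remote (heart covering) ∣ * (q * K)

    module Layer {a} (a∈W : a ∈ W) {j} (j≤k' : j ≤ k') {X v}
      (ball⊆X : ball a j ⊆ X) (X⊆ball : X ⊆ ball a (suc j)) (v∈ball : v ∈ ball a (suc j))
      (¬large : ¬ LargeNbhd X) (large : LargeNbhd (X ∪ ⁅ v ⁆)) where

      X⁺ : Subset N
      X⁺ = X ∪ ⁅ v ⁆

      X⁺⊆ball : X⁺ ⊆ ball a (suc j)
      X⁺⊆ball x∈X⁺ with x∈p∪q⁻ X ⁅ v ⁆ x∈X⁺
      ... | inj₁ x∈X = X⊆ball x∈X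
      ... | inj₂ x∈⁅v⁆ = subst (_∈ ball a (suc j)) (sym (x∈⁅y⁆⇒x≡y v x∈⁅v⁆)) v∈ball

      ∣X∣q<εN : ∣ X ∣ * q < p * N
      ∣X∣q<εN = ¬LargeNbhd⇒<εN (ball⊆W a∈W (suc j) ∘ X⊆ball) ¬large

      ∣X⁺∣q<2εN : ∣ X⁺ ∣ * q < 2 * (p * N)
      ∣X⁺∣q<2εN = begin-strict
        ∣ X⁺ ∣ * q            ≤⟨ *-monoˡ-≤ q (≤-trans (∣p∪q∣≤∣p∣+∣q∣ X ⁅ v ⁆) (≤-reflexive (cong (∣ X ∣ +_) (∣⁅x⁆∣≡1 v)))) ⟩
        (∣ X ∣ + 1) * q      ≡⟨ *-distribʳ-+ q ∣ X ∣ 1 ⟩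
        ∣ X ∣ * q + 1 * q    <⟨ +-mono-< ∣X∣q<εN (subst (_< p * N) (sym (*-identityˡ q)) 1<εN) ⟩
        p * N + p * N        ≡⟨ m+m≡2*m (p * N) ⟩
        2 * (p * N)          ∎
        where open ≤-Reasoning

      ∣N[X⁺]∣≤ : ∣ closedNbhd X⁺ ∣ ≤ ∣ closedNbhd X ∣ + suc (degree G v)
      ∣N[X⁺]∣≤ = begin
        ∣ closedNbhd X⁺ ∣                         ≤⟨ p⊆q⇒∣p∣≤∣q∣ (closedNbhd-∪ X ⁅ v ⁆) ⟩
        ∣ closedNbhd X ∪ closedNbhd ⁅ v ⁆ ∣     ≤⟨ ∣p∪q∣≤∣p∣+∣q∣ (closedNbhd X) (closedNbhd ⁅ v ⁆) ⟩
        nX + ∣ closedNbhd ⁅ v ⁆ ∣               ≤⟨ +-monoʳ-≤ nX (p⊆q⇒∣p∣≤∣q∣ (closedNbhd-⁅⁆ {v})) ⟩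
        nX + ∣ ⁅ v ⁆ ∪ nbhd G v ∣               ≤⟨ +-monoʳ-≤ nX (∣p∪q∣≤∣p∣+∣q∣ ⁅ v ⁆ (nbhd G v)) ⟩
        nX + (∣ ⁅ v ⁆ ∣ + degree G v)           ≡⟨ cong (λ s → nX + (s + degree G v)) (∣⁅x⁆∣≡1 v) ⟩
        nX + suc (degree G v)                    ∎
        where
        open ≤-Reasoning
        nX = ∣ closedNbhd X ∣

      base-large : N ≤ ∣ closedNbhd X⁺ ─ X⁺ ∣ * K
      base-large = <⇒≤ (*-cancelʳ-< q N (∣ B ∣ * K) (subst (N * q <_) (swap ∣ B ∣ q K) Nq<∣B∣qK))
        where
        B = closedNbhd X⁺ ─ X⁺
        Nq<∣B∣qK : N * q < ∣ B ∣ * (q * K)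
        Nq<∣B∣qK = large-difference (N * q) {p * N * K} {∣ closedNbhd X⁺ ∣} {∣ X⁺ ∣} {∣ B ∣} large
                     (∣p∣≤∣q∣+∣p─q∣ (closedNbhd X⁺) X⁺) (scale₂ ∣ X⁺ ∣ ∣X⁺∣q<2εN)
        swap : ∀ b q K → b * (q * K) ≡ b * K * q
        swap = solve-∀

      remote-large : ∣ W ∣ * (q * K) < N * q + 4 * (p * N * K) + ∣ remote X⁺ ∣ * (q * K)
      remote-large = begin-strict
        ∣ W ∣ * (q * K)                      ≤⟨ *-monoˡ-≤ (q * K) (∣W∣≤∣closedNbhd∣+∣remote∣ X⁺) ⟩
        (nX⁺ + r) * (q * K)                   ≤⟨ *-monoˡ-≤ (q * K) (+-monoˡ-≤ r ∣N[X⁺]∣≤) ⟩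
        (nX + suc d + r) * (q * K)           ≡⟨ expand nX (suc d) r (q * K) ⟩
        nX * (q * K) + suc d * (q * K) + r * (q * K)
          <⟨ +-monoˡ-< (r * (q * K)) (+-mono-< (≰⇒> ¬large) (scale₂ (suc d) 1+d<2εN)) ⟩
        N * q + 2 * (p * N * K) + 2 * (p * N * K) + r * (q * K)
          ≡⟨ cong (_+ r * (q * K)) (regroup (N * q) (p * N * K)) ⟩
        N * q + 4 * (p * N * K) + r * (q * K) ∎
        where
        open ≤-Reasoning
        nX⁺ = ∣ closedNbhd X⁺ ∣
        nX = ∣ closedNbhd X ∣
        r = ∣ remote X⁺ ∣
        d = degree G v
        1+d<2εN : suc d * q < 2 * (p * N)
        1+d<2εN = subst (q + d * q <_) (m+m≡2*m (p * N)) (+-mono-< 1<εN (sparse v))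
        expand : ∀ a b c z → (a + b + c) * z ≡ a * z + b * z + c * z
        expand = solve-∀
        regroup : ∀ A P → A + 2 * P + 2 * P ≡ A + 4 * P
        regroup = solve-∀

      outcome : Outcome
      outcome = record
        { covering   = layerCovering a∈W j ball⊆X⁺ X⁺⊆ball (v , x∈p∪q⁺ (inj₂ (x∈⁅x⁆ v)))
        ; heart⊆W    = ball⊆W a∈W (suc j) ∘ X⁺⊆ball
        ; base⊆W     = closedNbhd⊆W ∘ p─q⊆p (closedNbhd X⁺) X⁺
        ; height     = layerCovering-height a∈W j ball⊆X⁺ X⁺⊆ball (s≤s j≤k') (v , x∈p∪q⁺ (inj₂ (x∈⁅x⁆ v)))
        ; base-large = base-large
        ; remote-large = remote-large
        }
        where
        ball⊆X⁺ : ball a j ⊆ X⁺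
        ball⊆X⁺ = p⊆p∪q ⁅ v ⁆ ∘ ball⊆X

    stage : ∀ {a} → a ∈ W → εN¹⁻ᶜ≤ (ball a (suc k')) → Outcome
    stage {a} a∈W thick
      with crossing (λ r → LargeNbhd? (ball a r)) ¬LargeNbhd-⊥ (thick⇒LargeNbhd (ball⊆W a∈W (suc k')) thick)
    ... | j , j<1+k' , ¬large-j , large-1+j
      with crossing-⊆ LargeNbhd? LargeNbhd-mono (ball-step a∈W j) ¬large-j large-1+j
    ...   | X , v , ball⊆X , X⊆ball , v∈ball , ¬large , large =
      Layer.outcome a∈W (s≤s⁻¹ j<1+k') ball⊆X X⊆ball v∈ball ¬large large

    extend : ∀ {n} (o : Outcome) → CoveringSequenceIn (remote (heart (Outcome.covering o))) n (2 * K) →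
      CoveringSequenceIn W (suc n) K
    extend {n} o seq = record
      { L = L
      ; sequence = sequence
      ; ordered = ordered
      ; height = λ { zero → O.height ; (suc i) → S.height i }
      ; base-large = base-large
      ; heart⊆W = λ { zero → O.heart⊆W ; (suc i) → remote⊆W ∘ S.heart⊆W i }
      ; base⊆W = λ { zero → O.base⊆W ; (suc i) → remote⊆W ∘ S.base⊆W i }
      }
      where
      module O = Outcome o
      module S = CoveringSequenceIn seq
      L : Fin (suc n) → Covering G
      L zero = O.covering
      L (suc i) = S.L i
      sequence : IsCoveringSequence G L
      sequence zero zero 0≢0 = contradiction refl 0≢0
      sequence zero (suc j) _ =
        (λ v v∈H v∈Hj → remote-disjoint O.heart⊆W v v∈H (S.heart⊆W j v∈Hj)) ,
        (λ u v u∈H v∈Hj → remote-anticomplete u v u∈H (S.heart⊆W j v∈Hj))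
      sequence (suc i) zero _ =
        (λ v v∈Hi v∈H → remote-disjoint O.heart⊆W v v∈H (S.heart⊆W i v∈Hi)) ,
        (λ u v u∈Hi v∈H uv → remote-anticomplete v u v∈H (S.heart⊆W i u∈Hi) (Adj-sym G uv))
      sequence (suc i) (suc j) i≢j = S.sequence i j (i≢j ∘ cong suc)
      ordered : ∀ i j → i Fin.< j → Anticomplete G (heart (L i)) (base (L j))
      ordered zero (suc j) _ u v u∈H v∈Bj = remote-anticomplete u v u∈H (S.base⊆W j v∈Bj)
      ordered (suc i) (suc j) (s≤s i<j) = S.ordered i j i<j
      base-large : ∀ i → N ≤ ∣ base (L i) ∣ * (2 ^ toℕ i * K)
      base-large zero = subst (λ m → N ≤ ∣ base O.covering ∣ * m) (sym (+-identityʳ K)) O.base-large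
      base-large (suc i) = subst (λ m → N ≤ ∣ base (S.L i) ∣ * m) (regroup (2 ^ toℕ i) K) (S.base-large i)
        where
        regroup : ∀ a K → a * (2 * K) ≡ 2 * a * K
        regroup = solve-∀

  module Iteration (sparse : Sparse G p q) (1<N : 1 < N) (2p≤q : 2 * p ≤ q)
    (ρ : ℕ) (1≤ρ : 1 ≤ ρ) (ρ^k≤N : ρ ^ suc k' ≤ N) (N<[1+ρ]^k : N < suc ρ ^ suc k') where

    -- |W| + εN ≥ N/K + 4dεN, multiplied through by qK: room for d more stages, run with 2K, 4K, ….
    Budget : ℕ → ℕ → Subset N → Set
    Budget d K W = N * q + 4 * d * (p * N * K) ≤ (∣ W ∣ * q + p * N) * K

    coveringSequence : ∀ d K W → 0 < K → Budget d K W → CoveringSequenceIn W d (2 * K)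
    coveringSequence zero K W _ _ = record
      { L = λ () ; sequence = λ () ; ordered = λ () ; height = λ ()
      ; base-large = λ () ; heart⊆W = λ () ; base⊆W = λ () }
    coveringSequence (suc d) K W 0<K budget =
      extend outcome (coveringSequence d (2 * K) _ 0<2K remote-budget)
      where
      0<2K : 0 < 2 * K
      0<2K = ≤-trans 0<K (m≤n*m K 2)
      1<εN : q < p * N
      1<εN = coherent⇒1<εN sparse 1<N
      stage-budget : N * q + 3 * (p * N * (2 * K)) ≤ ∣ W ∣ * (q * (2 * K))
      stage-budget = budget⇒stage-budget d {N * q} {p * N} {∣ W ∣} budget
      open Within G W
      open Stage sparse 1<εN (2 * K) 0<2K W stage-budget
      thick-ball : ∃[ a ] (a ∈ W × εN¹⁻ᶜ≤ (ball a (suc k')))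
      thick-ball = BallLemma.∃-thick-ball ρ 1≤ρ ρ^k≤N N<[1+ρ]^k 2p≤q (≤-<-trans z≤n 1<εN) W
        (stage-budget⇒3εN {N * q} {p * N} {∣ W ∣} 0<2K stage-budget)
      outcome : Outcome
      outcome = stage (proj₁ (proj₂ thick-ball)) (proj₂ (proj₂ thick-ball))
      remote-budget : Budget d (2 * K) (remote (heart (Outcome.covering outcome)))
      remote-budget = budget-step d {N * q} {p * N} {∣ W ∣} {∣ remote (heart (Outcome.covering outcome)) ∣}
                        budget (Outcome.remote-large outcome)

mainTheorem13 : (n k p q N : ℕ) → 1 ≤ k → 0 Data.Nat.< p → 0 Data.Nat.< q →
    p * 2 ^ (n + 2) ≤ q →
    (G : Graph N) → Sparse G p q → Coherent G k p q → 1 Data.Nat.< N →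
    Σ (Fin n → Covering G) λ L →
      IsCoveringSequence G L
      × (∀ (i j : Fin n) → i Data.Fin.< j → Anticomplete G (heart (L i)) (base (L j)))
      × (∀ (i : Fin n) → HeightAtMost G k (L i))
      × (∀ (i : Fin n) → N ≤ ∣ base (L i) ∣ * 2 ^ (toℕ i + 2))
mainTheorem13 n (suc k') p q N _ _ _ p2^[n+2]≤q G sparse coherent 1<N with ∃-root k' (<-trans z<s 1<N)
... | ρ , 1≤ρ , ρ^k≤N , N<[1+ρ]^k = L , sequence , ordered , height , base-large'
  where
  2p≤q : 2 * p ≤ q
  2p≤q = ≤-trans (≤-reflexive (*-comm 2 p)) (≤-trans (*-monoʳ-≤ p 2≤2^[n+2]) p2^[n+2]≤q)
    where
    2≤2^[n+2] : 2 ^ 1 ≤ 2 ^ (n + 2)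
    2≤2^[n+2] = ^-monoʳ-≤ 2 (≤-trans (s≤s z≤n) (m≤n+m 2 n))
  open Iteration G k' p q coherent sparse 1<N 2p≤q ρ 1≤ρ ρ^k≤N N<[1+ρ]^k
  budget : Budget n 2 ⊤
  budget = subst (λ w → N * q + 4 * n * (p * N * 2) ≤ (w * q + p * N) * 2) (sym (∣⊤∣≡n N))
             (initial-budget n {p} {q} {N} p2^[n+2]≤q)
  open CoveringSequenceIn (coveringSequence n 2 ⊤ (s≤s z≤n) budget)
  base-large' : ∀ (i : Fin n) → N ≤ ∣ base (L i) ∣ * 2 ^ (toℕ i + 2)
  base-large' i = subst (λ m → N ≤ ∣ base (L i) ∣ * m) (sym (^-distribˡ-+-* 2 (toℕ i) 2)) (base-large i)
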